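{- Let $\mathfrak A$ be a J-algebra and let $a,b\in A$ satisfy $a^{\smile};a\le1'$, $b^{\smile};b\le1'$, $1=a^{\smile};b$, $1=a;1=b;1$, and $a;a^{\smile}\cdot b;b^{\smile}\le1'$. Let $A=a;(a^{\smile})^2\cdot b;a;b^{\smile};a^{\smile}\cdot b^2;b^{\smile}$ and, for $x,y\in A$, $x\otimes y=a;x;a^{\smile}\cdot b;y;b^{\smile}$. Then for all $x$, $$A;(1'\otimes x);A^{\smile}=1'\otimes(1'\otimes x),\qquad A^{\smile};(x\otimes1');A=(x\otimes1')\otimes1'.$$
   Context: A J-algebra is an algebra $\langle A,\cdot,0,1,;,{}^{\smile},1'\rangle$ satisfying for all $x,y,z$: $x\cdot(y\cdot z)=(x\cdot y)\cdot z$, $x\cdot y=y\cdot x$, $x\cdot x=x$, $x;(y;z)=(x;y);z$, $x;1'=x$, $(x\cdot y);z=(x\cdot y);z\cdot y;z$, $x^{\smile\smile}=x$, $(x;y)^{\smile}=y^{\smile};x^{\smile}$, $(x\cdot y)^{\smile}=x^{\smile}\cdot y^{\smile}$, $x;y\cdot z=(z;y^{\smile}\cdot x);(y\cdot x^{\smile};z)\cdot z$, $0\cdot x=0$, $x\cdot1=x$, $x;0=0$. Converse binds tightest, then $;$, then $\cdot$; $x^n$ is the $n$-fold relative product. $x\le y$ means $x\cdot y=x$. (The element named $A$ is distinct from the universe $A$.) -}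

module Defs where

open import Level using (Level; suc; _⊔_)
open import Relation.Binary.PropositionalEquality using (_≡_)

record JAlgebra (ℓ : Level) : Set (suc ℓ) where
  infixl 6 _·_
  infixl 7 _⨾_
  infix 8 _˘
  field
    Carrier : Set ℓ
    _·_     : Carrier → Carrier → Carrier
    𝟘       : Carrier
    𝟙       : Carrier
    _⨾_     : Carrier → Carrier → Carrier
    _˘      : Carrier → Carrier
    1'      : Carrier
    ·-assoc   : ∀ x y z → x · (y · z) ≡ (x · y) · z
    ·-comm    : ∀ x y → x · y ≡ y · x
    ·-idem    : ∀ x → x · x ≡ x
    ⨾-assoc   : ∀ x y z → x ⨾ (y ⨾ z) ≡ (x ⨾ y) ⨾ z
    ⨾-identʳ  : ∀ x → x ⨾ 1' ≡ x
    ·-⨾-sub   : ∀ x y z → (x · y) ⨾ z ≡ (x · y) ⨾ z · y ⨾ z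
    ˘-invol   : ∀ x → x ˘ ˘ ≡ x
    ˘-⨾       : ∀ x y → (x ⨾ y) ˘ ≡ y ˘ ⨾ x ˘
    ˘-·       : ∀ x y → (x · y) ˘ ≡ x ˘ · y ˘
    modular   : ∀ x y z → x ⨾ y · z ≡ (z ⨾ y ˘ · x) ⨾ (y · x ˘ ⨾ z) · z
    𝟘-·       : ∀ x → 𝟘 · x ≡ 𝟘
    ·-𝟙       : ∀ x → x · 𝟙 ≡ x
    ⨾-𝟘       : ∀ x → x ⨾ 𝟘 ≡ 𝟘

  infix 4 _≤_
  _≤_ : Carrier → Carrier → Set ℓ
  x ≤ y = x · y ≡ x

-- Read a and b as the two projections of a pairing U ≅ U × U: they are maps, every
-- pair of points is realised (a˘ ⨾ b = 𝟙) and a point is determined by its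
-- projections (a ⨾ a˘ · b ⨾ b˘ ≤ 1').  The fork ⟨f , h⟩ = f ⨾ a˘ · h ⨾ b˘ of two maps
-- is then a map with projections f and h, and x ⊗ y = ⟨a ⨾ x , b ⨾ y⟩.  The element A
-- (α below) is the associator ⟨⟨a , b ⨾ a⟩ , b ⨾ b⟩, and its converse is ⟨a ⨾ a , ⟨a ⨾ b , b⟩⟩.
-- Conjugating x ⊗ y by a map f distributes over the meet and yields the conjugates of x
-- and y by f ⨾ a and f ⨾ b; computing these projections for A and A˘ gives both identities.
module Submission where

open import Defs
open import Data.Product using (_×_; _,_)
open import Relation.Binary.PropositionalEquality
open import Relation.Binary.Bundles using (Poset)
import Relation.Binary.Reasoning.PartialOrder as PosetReasoning

module Relational {ℓ} (𝔄 : JAlgebra ℓ) where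
  open JAlgebra 𝔄

  private variable x y z f g h : Carrier

  ≤-reflexive : x ≡ y → x ≤ y
  ≤-reflexive {x} refl = ·-idem x

  ≤-trans : x ≤ y → y ≤ z → x ≤ z
  ≤-trans {x} {y} {z} p q = begin
    x · z        ≡⟨ cong (_· z) (sym p) ⟩
    (x · y) · z  ≡⟨ sym (·-assoc x y z) ⟩
    x · (y · z)  ≡⟨ cong (x ·_) q ⟩
    x · y        ≡⟨ p ⟩
    x            ∎
    where open ≡-Reasoning

  ≤-antisym : x ≤ y → y ≤ x → x ≡ y
  ≤-antisym {x} {y} p q = trans (sym p) (trans (·-comm x y) q)

  ≤-poset : Poset ℓ ℓ ℓ
  ≤-poset = record
    { _≈_ = _≡_
    ; _≤_ = _≤_
    ; isPartialOrder = record
      { isPreorder = record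
        { isEquivalence = isEquivalence
        ; reflexive = ≤-reflexive
        ; trans = ≤-trans
        }
      ; antisym = ≤-antisym
      }
    }

  x·y≤x : x · y ≤ x
  x·y≤x {x} {y} = trans (·-comm (x · y) x) (trans (·-assoc x x y) (cong (_· y) (·-idem x)))

  x·y≤y : x · y ≤ y
  x·y≤y {x} {y} = trans (sym (·-assoc x y y)) (cong (x ·_) (·-idem y))

  ·-greatest : z ≤ x → z ≤ y → z ≤ x · y
  ·-greatest {z} {x} {y} p q = trans (·-assoc z x y) (trans (cong (_· y) p) q)

  ·-mono : x ≤ y → z ≤ h → x · z ≤ y · h
  ·-mono p q = ·-greatest (≤-trans x·y≤x p) (≤-trans x·y≤y q)

  x≤𝟙 : x ≤ 𝟙
  x≤𝟙 {x} = ·-𝟙 x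

  𝟙·x : 𝟙 · x ≡ x
  𝟙·x {x} = trans (·-comm 𝟙 x) (·-𝟙 x)

  ˘-mono : x ≤ y → x ˘ ≤ y ˘
  ˘-mono {x} {y} p = trans (sym (˘-· x y)) (cong _˘ p)

  ˘-⨾˘ : (x ⨾ y ˘) ˘ ≡ y ⨾ x ˘
  ˘-⨾˘ {x} {y} = trans (˘-⨾ x (y ˘)) (cong (_⨾ x ˘) (˘-invol y))

  ˘-˘⨾˘ : (x ˘ ⨾ y ˘) ˘ ≡ y ⨾ x
  ˘-˘⨾˘ {x} {y} = trans ˘-⨾˘ (cong (y ⨾_) (˘-invol x))

  1'˘ : 1' ˘ ≡ 1'
  1'˘ = begin
    1' ˘               ≡⟨ sym (⨾-identʳ (1' ˘)) ⟩
    1' ˘ ⨾ 1'          ≡⟨ cong (1' ˘ ⨾_) (sym (˘-invol 1')) ⟩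
    1' ˘ ⨾ 1' ˘ ˘      ≡⟨ sym (˘-⨾ (1' ˘) 1') ⟩
    (1' ˘ ⨾ 1') ˘      ≡⟨ cong _˘ (⨾-identʳ (1' ˘)) ⟩
    1' ˘ ˘             ≡⟨ ˘-invol 1' ⟩
    1'                 ∎
    where open ≡-Reasoning

  ⨾-identityˡ : ∀ x → 1' ⨾ x ≡ x
  ⨾-identityˡ x = begin
    1' ⨾ x             ≡⟨ cong₂ _⨾_ (sym 1'˘) (sym (˘-invol x)) ⟩
    1' ˘ ⨾ x ˘ ˘       ≡⟨ sym (˘-⨾ (x ˘) 1') ⟩
    (x ˘ ⨾ 1') ˘       ≡⟨ cong _˘ (⨾-identʳ (x ˘)) ⟩
    x ˘ ˘              ≡⟨ ˘-invol x ⟩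
    x                  ∎
    where open ≡-Reasoning

  ⨾-monoˡ : x ≤ y → x ⨾ z ≤ y ⨾ z
  ⨾-monoˡ {x} {y} {z} p = begin
    x ⨾ z · y ⨾ z        ≡⟨ cong (λ u → u ⨾ z · y ⨾ z) (sym p) ⟩
    (x · y) ⨾ z · y ⨾ z  ≡⟨ sym (·-⨾-sub x y z) ⟩
    (x · y) ⨾ z          ≡⟨ cong (_⨾ z) p ⟩
    x ⨾ z                ∎
    where open ≡-Reasoning

  ⨾-monoʳ : x ≤ y → z ⨾ x ≤ z ⨾ y
  ⨾-monoʳ {x} {y} {z} p =
    subst₂ _≤_ ˘-˘⨾˘ ˘-˘⨾˘ (˘-mono (⨾-monoˡ {z = z ˘} (˘-mono p)))

  ⨾-mono : x ≤ y → z ≤ h → x ⨾ z ≤ y ⨾ h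
  ⨾-mono p q = ≤-trans (⨾-monoˡ p) (⨾-monoʳ q)

  𝟙˘ : 𝟙 ˘ ≡ 𝟙
  𝟙˘ = ≤-antisym x≤𝟙 (subst (_≤ 𝟙 ˘) (˘-invol 𝟙) (˘-mono x≤𝟙))

  modular-≤ : x ⨾ y · z ≤ (z ⨾ y ˘ · x) ⨾ (y · x ˘ ⨾ z)
  modular-≤ {x} {y} {z} = subst (_≤ (z ⨾ y ˘ · x) ⨾ (y · x ˘ ⨾ z)) (sym (modular x y z)) x·y≤x

  modular-≤ʳ : x ⨾ y · z ≤ x ⨾ (y · x ˘ ⨾ z)
  modular-≤ʳ = ≤-trans modular-≤ (⨾-monoˡ x·y≤y)

  ⨾≡𝟙⇒1'≤⨾˘ : x ⨾ y ≡ 𝟙 → 1' ≤ (x · y ˘) ⨾ (x · y ˘) ˘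
  ⨾≡𝟙⇒1'≤⨾˘ {x} {y} xy≡𝟙 = begin
    1'                                 ≡⟨ sym (trans (cong (_· 1') xy≡𝟙) 𝟙·x) ⟩
    x ⨾ y · 1'                         ≤⟨ modular-≤ ⟩
    (1' ⨾ y ˘ · x) ⨾ (y · x ˘ ⨾ 1')    ≡⟨ cong₂ _⨾_ left right ⟩
    (x · y ˘) ⨾ (x · y ˘) ˘            ∎
    where
      open PosetReasoning ≤-poset
      left : 1' ⨾ y ˘ · x ≡ x · y ˘
      left = trans (cong (_· x) (⨾-identityˡ (y ˘))) (·-comm (y ˘) x)
      right : y · x ˘ ⨾ 1' ≡ (x · y ˘) ˘
      right = trans (cong (y ·_) (⨾-identʳ (x ˘)))
                (trans (·-comm y (x ˘)) (sym (trans (˘-· x (y ˘)) (cong (x ˘ ·_) (˘-invol y)))))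

  Total : Carrier → Set ℓ
  Total f = f ⨾ 𝟙 ≡ 𝟙

  Univalent : Carrier → Set ℓ
  Univalent f = f ˘ ⨾ f ≤ 1'

  total⇒1'≤⨾˘ : Total f → 1' ≤ f ⨾ f ˘
  total⇒1'≤⨾˘ {f} tf =
    subst (λ u → 1' ≤ u ⨾ u ˘) (trans (cong (f ·_) 𝟙˘) (·-𝟙 f)) (⨾≡𝟙⇒1'≤⨾˘ tf)

  1'≤⨾˘⇒total : 1' ≤ f ⨾ f ˘ → Total f
  1'≤⨾˘⇒total {f} 1'≤ff˘ = ≤-antisym x≤𝟙 (begin
    𝟙                ≡⟨ sym (⨾-identityˡ 𝟙) ⟩
    1' ⨾ 𝟙           ≤⟨ ⨾-monoˡ 1'≤ff˘ ⟩
    f ⨾ f ˘ ⨾ 𝟙      ≡⟨ sym (⨾-assoc f (f ˘) 𝟙) ⟩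
    f ⨾ (f ˘ ⨾ 𝟙)    ≤⟨ ⨾-monoʳ x≤𝟙 ⟩
    f ⨾ 𝟙            ∎)
    where open PosetReasoning ≤-poset

  total-⨾ : Total f → Total g → Total (f ⨾ g)
  total-⨾ {f} {g} tf tg = trans (sym (⨾-assoc f g 𝟙)) (trans (cong (f ⨾_) tg) tf)

  total⇒𝟙⨾˘ : Total f → 𝟙 ⨾ f ˘ ≡ 𝟙
  total⇒𝟙⨾˘ {f} tf = begin
    𝟙 ⨾ f ˘          ≡⟨ cong (_⨾ f ˘) (sym 𝟙˘) ⟩
    𝟙 ˘ ⨾ f ˘        ≡⟨ sym (˘-⨾ f 𝟙) ⟩
    (f ⨾ 𝟙) ˘        ≡⟨ cong _˘ tf ⟩
    𝟙 ˘              ≡⟨ 𝟙˘ ⟩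
    𝟙                ∎
    where open ≡-Reasoning

  univalent⇒⨾˘⨾-≤ : Univalent f → x ⨾ f ˘ ⨾ f ≤ x
  univalent⇒⨾˘⨾-≤ {f} {x} uf = begin
    x ⨾ f ˘ ⨾ f      ≡⟨ sym (⨾-assoc x (f ˘) f) ⟩
    x ⨾ (f ˘ ⨾ f)    ≤⟨ ⨾-monoʳ uf ⟩
    x ⨾ 1'           ≡⟨ ⨾-identʳ x ⟩
    x                ∎
    where open PosetReasoning ≤-poset

  univalent⇒˘⨾-≤ : Univalent f → (f ⨾ x) ˘ ⨾ (f ⨾ x) ≤ x ˘ ⨾ x
  univalent⇒˘⨾-≤ {f} {x} uf = begin
    (f ⨾ x) ˘ ⨾ (f ⨾ x)     ≡⟨ cong (_⨾ (f ⨾ x)) (˘-⨾ f x) ⟩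
    x ˘ ⨾ f ˘ ⨾ (f ⨾ x)     ≡⟨ ⨾-assoc (x ˘ ⨾ f ˘) f x ⟩
    x ˘ ⨾ f ˘ ⨾ f ⨾ x       ≤⟨ ⨾-monoˡ (univalent⇒⨾˘⨾-≤ uf) ⟩
    x ˘ ⨾ x                 ∎
    where open PosetReasoning ≤-poset

  univalent-⨾ : Univalent f → Univalent g → Univalent (f ⨾ g)
  univalent-⨾ uf ug = ≤-trans (univalent⇒˘⨾-≤ uf) ug

  ˘⨾-·-≤ : (x · y) ˘ ⨾ (x · y) ≤ x ˘ ⨾ x · y ˘ ⨾ y
  ˘⨾-·-≤ = ·-greatest (⨾-mono (˘-mono x·y≤x) x·y≤x) (⨾-mono (˘-mono x·y≤y) x·y≤y)

  univalent⇒⨾-distribˡ-· : Univalent f → f ⨾ (x · y) ≡ f ⨾ x · f ⨾ y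
  univalent⇒⨾-distribˡ-· {f} {x} {y} uf = ≤-antisym
    (·-greatest (⨾-monoʳ x·y≤x) (⨾-monoʳ x·y≤y))
    (begin
      f ⨾ x · f ⨾ y              ≤⟨ modular-≤ʳ ⟩
      f ⨾ (x · f ˘ ⨾ (f ⨾ y))    ≤⟨ ⨾-monoʳ (·-mono (≤-reflexive refl) f˘⨾f⨾y≤y) ⟩
      f ⨾ (x · y)                ∎)
    where
      open PosetReasoning ≤-poset
      f˘⨾f⨾y≤y : f ˘ ⨾ (f ⨾ y) ≤ y
      f˘⨾f⨾y≤y = subst (_≤ y) (sym (⨾-assoc (f ˘) f y))
                   (≤-trans (⨾-monoˡ uf) (≤-reflexive (⨾-identityˡ y)))

  univalent⇒⨾˘-distribʳ-· : Univalent f → (x · y) ⨾ f ˘ ≡ x ⨾ f ˘ · y ⨾ f ˘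
  univalent⇒⨾˘-distribʳ-· {f} {x} {y} uf = begin
    (x · y) ⨾ f ˘                    ≡⟨ sym ˘-⨾˘ ⟩
    (f ⨾ (x · y) ˘) ˘                ≡⟨ cong (λ u → (f ⨾ u) ˘) (˘-· x y) ⟩
    (f ⨾ (x ˘ · y ˘)) ˘              ≡⟨ cong _˘ (univalent⇒⨾-distribˡ-· uf) ⟩
    (f ⨾ x ˘ · f ⨾ y ˘) ˘            ≡⟨ ˘-· (f ⨾ x ˘) (f ⨾ y ˘) ⟩
    (f ⨾ x ˘) ˘ · (f ⨾ y ˘) ˘        ≡⟨ cong₂ _·_ ˘-⨾˘ ˘-⨾˘ ⟩
    x ⨾ f ˘ · y ⨾ f ˘                ∎
    where open ≡-Reasoning

  univalent⇒conj-distrib-· : Univalent f → f ⨾ (x · y) ⨾ f ˘ ≡ f ⨾ x ⨾ f ˘ · f ⨾ y ⨾ f ˘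
  univalent⇒conj-distrib-· {f} uf =
    trans (cong (_⨾ f ˘) (univalent⇒⨾-distribˡ-· uf)) (univalent⇒⨾˘-distribʳ-· uf)

  ⨾-conj : f ⨾ (g ⨾ x ⨾ g ˘) ⨾ f ˘ ≡ (f ⨾ g) ⨾ x ⨾ (f ⨾ g) ˘
  ⨾-conj {f} {g} {x} = begin
    f ⨾ (g ⨾ x ⨾ g ˘) ⨾ f ˘    ≡⟨ cong (_⨾ f ˘) (⨾-assoc f (g ⨾ x) (g ˘)) ⟩
    f ⨾ (g ⨾ x) ⨾ g ˘ ⨾ f ˘    ≡⟨ sym (⨾-assoc (f ⨾ (g ⨾ x)) (g ˘) (f ˘)) ⟩
    f ⨾ (g ⨾ x) ⨾ (g ˘ ⨾ f ˘)  ≡⟨ cong₂ _⨾_ (⨾-assoc f g x) (sym (˘-⨾ f g)) ⟩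
    f ⨾ g ⨾ x ⨾ (f ⨾ g) ˘      ∎
    where open ≡-Reasoning

  conj-cong : f ≡ g → f ⨾ x ⨾ f ˘ ≡ g ⨾ x ⨾ g ˘
  conj-cong {x = x} = cong (λ u → u ⨾ x ⨾ u ˘)

  total≤univalent⇒≡ : g ≤ f → Total g → Univalent f → g ≡ f
  total≤univalent⇒≡ {g} {f} g≤f tg uf = ≤-antisym g≤f (begin
    f                 ≡⟨ sym (⨾-identityˡ f) ⟩
    1' ⨾ f            ≤⟨ ⨾-monoˡ (total⇒1'≤⨾˘ tg) ⟩
    g ⨾ g ˘ ⨾ f       ≤⟨ ⨾-monoˡ (⨾-monoʳ (˘-mono g≤f)) ⟩
    g ⨾ f ˘ ⨾ f       ≤⟨ univalent⇒⨾˘⨾-≤ uf ⟩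
    g                 ∎)
    where open PosetReasoning ≤-poset

  module Pairing (a b : Carrier)
                 (a-univalent : Univalent a) (b-univalent : Univalent b)
                 (a˘⨾b≡𝟙 : a ˘ ⨾ b ≡ 𝟙) (a-total : Total a) (b-total : Total b)
                 (projections-injective : a ⨾ a ˘ · b ⨾ b ˘ ≤ 1') where

    fork : Carrier → Carrier → Carrier
    fork f h = f ⨾ a ˘ · h ⨾ b ˘

    infixl 6 _⊗_
    _⊗_ : Carrier → Carrier → Carrier
    x ⊗ y = a ⨾ x ⨾ a ˘ · b ⨾ y ⨾ b ˘

    1'⊗1' : 1' ⊗ 1' ≡ 1'
    1'⊗1' = ≤-antisym
      (subst (_≤ 1') (sym (cong₂ (λ u v → u ⨾ a ˘ · v ⨾ b ˘) (⨾-identʳ a) (⨾-identʳ b)))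
        projections-injective)
      (subst (1' ≤_) (cong₂ (λ u v → u ⨾ a ˘ · v ⨾ b ˘) (sym (⨾-identʳ a)) (sym (⨾-identʳ b)))
        (·-greatest (total⇒1'≤⨾˘ a-total) (total⇒1'≤⨾˘ b-total)))

    fork-total : Total f → Total h → Total (fork f h)
    fork-total {f} {h} tf th =
      1'≤⨾˘⇒total (subst (λ u → 1' ≤ (f ⨾ a ˘ · u) ⨾ (f ⨾ a ˘ · u) ˘) ˘-⨾˘ (⨾≡𝟙⇒1'≤⨾˘ realised))
      where
        open ≡-Reasoning
        realised : f ⨾ a ˘ ⨾ (b ⨾ h ˘) ≡ 𝟙
        realised = begin
          f ⨾ a ˘ ⨾ (b ⨾ h ˘)      ≡⟨ sym (⨾-assoc f (a ˘) (b ⨾ h ˘)) ⟩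
          f ⨾ (a ˘ ⨾ (b ⨾ h ˘))    ≡⟨ cong (f ⨾_) (⨾-assoc (a ˘) b (h ˘)) ⟩
          f ⨾ (a ˘ ⨾ b ⨾ h ˘)      ≡⟨ cong (λ u → f ⨾ (u ⨾ h ˘)) a˘⨾b≡𝟙 ⟩
          f ⨾ (𝟙 ⨾ h ˘)            ≡⟨ cong (f ⨾_) (total⇒𝟙⨾˘ th) ⟩
          f ⨾ 𝟙                    ≡⟨ tf ⟩
          𝟙                        ∎

    fork-univalent : Univalent f → Univalent h → Univalent (fork f h)
    fork-univalent {f} {h} uf uh = begin
      fork f h ˘ ⨾ fork f h                                  ≤⟨ ˘⨾-·-≤ ⟩
      (f ⨾ a ˘) ˘ ⨾ (f ⨾ a ˘) · (h ⨾ b ˘) ˘ ⨾ (h ⨾ b ˘)    ≤⟨ ·-mono (univalent⇒˘⨾-≤ uf) (univalent⇒˘⨾-≤ uh) ⟩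
      a ˘ ˘ ⨾ a ˘ · b ˘ ˘ ⨾ b ˘                              ≡⟨ cong₂ (λ u v → u ⨾ a ˘ · v ⨾ b ˘) (˘-invol a) (˘-invol b) ⟩
      a ⨾ a ˘ · b ⨾ b ˘                                      ≤⟨ projections-injective ⟩
      1'                                                     ∎
      where open PosetReasoning ≤-poset

    fork-⨾ˡ : Univalent f → Total f → Total h → fork f h ⨾ a ≡ f
    fork-⨾ˡ uf tf th = total≤univalent⇒≡
      (≤-trans (⨾-monoˡ x·y≤x) (univalent⇒⨾˘⨾-≤ a-univalent))
      (total-⨾ (fork-total tf th) a-total) uf

    fork-⨾ʳ : Univalent h → Total f → Total h → fork f h ⨾ b ≡ h
    fork-⨾ʳ uh tf th = total≤univalent⇒≡
      (≤-trans (⨾-monoˡ x·y≤y) (univalent⇒⨾˘⨾-≤ b-univalent))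
      (total-⨾ (fork-total tf th) b-total) uh

    conj-⊗ : Univalent f → f ⨾ (x ⊗ y) ⨾ f ˘ ≡ (f ⨾ a) ⨾ x ⨾ (f ⨾ a) ˘ · (f ⨾ b) ⨾ y ⨾ (f ⨾ b) ˘
    conj-⊗ uf = trans (univalent⇒conj-distrib-· uf) (cong₂ _·_ ⨾-conj ⨾-conj)

    conj-1' : Univalent f → f ⨾ 1' ⨾ f ˘ ≡ (f ⨾ a) ⨾ 1' ⨾ (f ⨾ a) ˘ · (f ⨾ b) ⨾ 1' ⨾ (f ⨾ b) ˘
    conj-1' {f} uf = trans (cong (λ u → f ⨾ u ⨾ f ˘) (sym 1'⊗1')) (conj-⊗ uf)

    α : Carrier
    α = a ⨾ (a ˘ ⨾ a ˘) · b ⨾ a ⨾ b ˘ ⨾ a ˘ · (b ⨾ b) ⨾ b ˘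

    α≡fork : α ≡ fork (fork a (b ⨾ a)) (b ⨾ b)
    α≡fork = cong (_· (b ⨾ b) ⨾ b ˘) (sym (begin
      (a ⨾ a ˘ · b ⨾ a ⨾ b ˘) ⨾ a ˘      ≡⟨ univalent⇒⨾˘-distribʳ-· a-univalent ⟩
      a ⨾ a ˘ ⨾ a ˘ · b ⨾ a ⨾ b ˘ ⨾ a ˘  ≡⟨ cong (_· b ⨾ a ⨾ b ˘ ⨾ a ˘) (sym (⨾-assoc a (a ˘) (a ˘))) ⟩
      a ⨾ (a ˘ ⨾ a ˘) · b ⨾ a ⨾ b ˘ ⨾ a ˘ ∎))
      where open ≡-Reasoning

    α˘≡fork : α ˘ ≡ fork (a ⨾ a) (fork (a ⨾ b) b)
    α˘≡fork = begin
      α ˘                                                              ≡⟨ ˘-· _ _ ⟩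
      (a ⨾ (a ˘ ⨾ a ˘) · b ⨾ a ⨾ b ˘ ⨾ a ˘) ˘ · ((b ⨾ b) ⨾ b ˘) ˘      ≡⟨ cong (_· ((b ⨾ b) ⨾ b ˘) ˘) (˘-· _ _) ⟩
      (a ⨾ (a ˘ ⨾ a ˘)) ˘ · (b ⨾ a ⨾ b ˘ ⨾ a ˘) ˘ · ((b ⨾ b) ⨾ b ˘) ˘  ≡⟨ cong₂ _·_ (cong₂ _·_ first second) third ⟩
      a ⨾ a ⨾ a ˘ · (a ⨾ b ⨾ a ˘) ⨾ b ˘ · (b ⨾ b ˘) ⨾ b ˘             ≡⟨ sym (·-assoc _ _ _) ⟩
      a ⨾ a ⨾ a ˘ · ((a ⨾ b ⨾ a ˘) ⨾ b ˘ · (b ⨾ b ˘) ⨾ b ˘)           ≡⟨ cong (a ⨾ a ⨾ a ˘ ·_) (sym (univalent⇒⨾˘-distribʳ-· b-univalent)) ⟩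
      fork (a ⨾ a) (fork (a ⨾ b) b)                                    ∎
      where
        open ≡-Reasoning
        first : (a ⨾ (a ˘ ⨾ a ˘)) ˘ ≡ a ⨾ a ⨾ a ˘
        first = trans (˘-⨾ a _) (cong (_⨾ a ˘) ˘-˘⨾˘)
        second : (b ⨾ a ⨾ b ˘ ⨾ a ˘) ˘ ≡ a ⨾ b ⨾ a ˘ ⨾ b ˘
        second = begin
          (b ⨾ a ⨾ b ˘ ⨾ a ˘) ˘        ≡⟨ ˘-⨾˘ ⟩
          a ⨾ (b ⨾ a ⨾ b ˘) ˘          ≡⟨ cong (a ⨾_) ˘-⨾˘ ⟩
          a ⨾ (b ⨾ (b ⨾ a) ˘)          ≡⟨ cong (λ u → a ⨾ (b ⨾ u)) (˘-⨾ b a) ⟩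
          a ⨾ (b ⨾ (a ˘ ⨾ b ˘))        ≡⟨ ⨾-assoc a b _ ⟩
          a ⨾ b ⨾ (a ˘ ⨾ b ˘)          ≡⟨ ⨾-assoc (a ⨾ b) (a ˘) (b ˘) ⟩
          a ⨾ b ⨾ a ˘ ⨾ b ˘            ∎
        third : ((b ⨾ b) ⨾ b ˘) ˘ ≡ (b ⨾ b ˘) ⨾ b ˘
        third = trans ˘-⨾˘ (trans (cong (b ⨾_) (˘-⨾ b b)) (⨾-assoc b (b ˘) (b ˘)))

    a⨾a-univalent : Univalent (a ⨾ a)
    a⨾a-univalent = univalent-⨾ a-univalent a-univalent

    b⨾b-univalent : Univalent (b ⨾ b)
    b⨾b-univalent = univalent-⨾ b-univalent b-univalent

    a⨾b-univalent : Univalent (a ⨾ b)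
    a⨾b-univalent = univalent-⨾ a-univalent b-univalent

    b⨾a-univalent : Univalent (b ⨾ a)
    b⨾a-univalent = univalent-⨾ b-univalent a-univalent

    fork-a-ba-univalent : Univalent (fork a (b ⨾ a))
    fork-a-ba-univalent = fork-univalent a-univalent b⨾a-univalent

    fork-a-ba-total : Total (fork a (b ⨾ a))
    fork-a-ba-total = fork-total a-total (total-⨾ b-total a-total)

    fork-ab-b-univalent : Univalent (fork (a ⨾ b) b)
    fork-ab-b-univalent = fork-univalent a⨾b-univalent b-univalent

    fork-ab-b-total : Total (fork (a ⨾ b) b)
    fork-ab-b-total = fork-total (total-⨾ a-total b-total) b-total

    α-univalent : Univalent α
    α-univalent = subst Univalent (sym α≡fork) (fork-univalent fork-a-ba-univalent b⨾b-univalent)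

    α˘-univalent : Univalent (α ˘)
    α˘-univalent = subst Univalent (sym α˘≡fork) (fork-univalent a⨾a-univalent fork-ab-b-univalent)

    α⨾a≡fork : α ⨾ a ≡ fork a (b ⨾ a)
    α⨾a≡fork = trans (cong (_⨾ a) α≡fork)
      (fork-⨾ˡ fork-a-ba-univalent fork-a-ba-total (total-⨾ b-total b-total))

    α⨾b≡b⨾b : α ⨾ b ≡ b ⨾ b
    α⨾b≡b⨾b = trans (cong (_⨾ b) α≡fork)
      (fork-⨾ʳ b⨾b-univalent fork-a-ba-total (total-⨾ b-total b-total))

    α˘⨾a≡a⨾a : α ˘ ⨾ a ≡ a ⨾ a
    α˘⨾a≡a⨾a = trans (cong (_⨾ a) α˘≡fork)
      (fork-⨾ˡ a⨾a-univalent (total-⨾ a-total a-total) fork-ab-b-total)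

    α˘⨾b≡fork : α ˘ ⨾ b ≡ fork (a ⨾ b) b
    α˘⨾b≡fork = trans (cong (_⨾ b) α˘≡fork)
      (fork-⨾ʳ fork-ab-b-univalent (total-⨾ a-total a-total) fork-ab-b-total)

    α-conj-1'⊗ : ∀ x → α ⨾ (1' ⊗ x) ⨾ α ˘ ≡ 1' ⊗ (1' ⊗ x)
    α-conj-1'⊗ x = begin
      α ⨾ (1' ⊗ x) ⨾ α ˘
        ≡⟨ conj-⊗ α-univalent ⟩
      (α ⨾ a) ⨾ 1' ⨾ (α ⨾ a) ˘ · (α ⨾ b) ⨾ x ⨾ (α ⨾ b) ˘
        ≡⟨ cong₂ _·_ (conj-cong α⨾a≡fork) (conj-cong α⨾b≡b⨾b) ⟩
      fork a (b ⨾ a) ⨾ 1' ⨾ fork a (b ⨾ a) ˘ · (b ⨾ b) ⨾ x ⨾ (b ⨾ b) ˘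
        ≡⟨ cong (_· (b ⨾ b) ⨾ x ⨾ (b ⨾ b) ˘) (conj-1' fork-a-ba-univalent) ⟩
      (fork a (b ⨾ a) ⨾ a) ⨾ 1' ⨾ (fork a (b ⨾ a) ⨾ a) ˘ · (fork a (b ⨾ a) ⨾ b) ⨾ 1' ⨾ (fork a (b ⨾ a) ⨾ b) ˘
        · (b ⨾ b) ⨾ x ⨾ (b ⨾ b) ˘
        ≡⟨ cong (_· (b ⨾ b) ⨾ x ⨾ (b ⨾ b) ˘) (cong₂ _·_
             (conj-cong (fork-⨾ˡ a-univalent a-total (total-⨾ b-total a-total)))
             (conj-cong (fork-⨾ʳ b⨾a-univalent a-total (total-⨾ b-total a-total)))) ⟩
      a ⨾ 1' ⨾ a ˘ · (b ⨾ a) ⨾ 1' ⨾ (b ⨾ a) ˘ · (b ⨾ b) ⨾ x ⨾ (b ⨾ b) ˘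
        ≡⟨ sym (·-assoc _ _ _) ⟩
      a ⨾ 1' ⨾ a ˘ · ((b ⨾ a) ⨾ 1' ⨾ (b ⨾ a) ˘ · (b ⨾ b) ⨾ x ⨾ (b ⨾ b) ˘)
        ≡⟨ cong (a ⨾ 1' ⨾ a ˘ ·_) (sym (conj-⊗ b-univalent)) ⟩
      1' ⊗ (1' ⊗ x)
        ∎
      where open ≡-Reasoning

    α˘-conj-⊗1' : ∀ x → α ˘ ⨾ (x ⊗ 1') ⨾ α ≡ (x ⊗ 1') ⊗ 1'
    α˘-conj-⊗1' x = begin
      α ˘ ⨾ (x ⊗ 1') ⨾ α
        ≡⟨ cong (α ˘ ⨾ (x ⊗ 1') ⨾_) (sym (˘-invol α)) ⟩
      α ˘ ⨾ (x ⊗ 1') ⨾ α ˘ ˘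
        ≡⟨ conj-⊗ α˘-univalent ⟩
      (α ˘ ⨾ a) ⨾ x ⨾ (α ˘ ⨾ a) ˘ · (α ˘ ⨾ b) ⨾ 1' ⨾ (α ˘ ⨾ b) ˘
        ≡⟨ cong₂ _·_ (conj-cong α˘⨾a≡a⨾a) (conj-cong α˘⨾b≡fork) ⟩
      (a ⨾ a) ⨾ x ⨾ (a ⨾ a) ˘ · fork (a ⨾ b) b ⨾ 1' ⨾ fork (a ⨾ b) b ˘
        ≡⟨ cong ((a ⨾ a) ⨾ x ⨾ (a ⨾ a) ˘ ·_) (conj-1' fork-ab-b-univalent) ⟩
      (a ⨾ a) ⨾ x ⨾ (a ⨾ a) ˘
        · ((fork (a ⨾ b) b ⨾ a) ⨾ 1' ⨾ (fork (a ⨾ b) b ⨾ a) ˘ · (fork (a ⨾ b) b ⨾ b) ⨾ 1' ⨾ (fork (a ⨾ b) b ⨾ b) ˘)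
        ≡⟨ cong ((a ⨾ a) ⨾ x ⨾ (a ⨾ a) ˘ ·_) (cong₂ _·_
             (conj-cong (fork-⨾ˡ a⨾b-univalent (total-⨾ a-total b-total) b-total))
             (conj-cong (fork-⨾ʳ b-univalent (total-⨾ a-total b-total) b-total))) ⟩
      (a ⨾ a) ⨾ x ⨾ (a ⨾ a) ˘ · ((a ⨾ b) ⨾ 1' ⨾ (a ⨾ b) ˘ · b ⨾ 1' ⨾ b ˘)
        ≡⟨ ·-assoc _ _ _ ⟩
      (a ⨾ a) ⨾ x ⨾ (a ⨾ a) ˘ · (a ⨾ b) ⨾ 1' ⨾ (a ⨾ b) ˘ · b ⨾ 1' ⨾ b ˘
        ≡⟨ cong (_· b ⨾ 1' ⨾ b ˘) (sym (conj-⊗ a-univalent)) ⟩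
      (x ⊗ 1') ⊗ 1'
        ∎
      where open ≡-Reasoning

proposition72 : ∀ {ℓ} (𝔄 : JAlgebra ℓ) → let open JAlgebra 𝔄 in
    (a b : Carrier) →
    a ˘ ⨾ a ≤ 1' → b ˘ ⨾ b ≤ 1' → 𝟙 ≡ a ˘ ⨾ b →
    𝟙 ≡ a ⨾ 𝟙 → 𝟙 ≡ b ⨾ 𝟙 → a ⨾ a ˘ · b ⨾ b ˘ ≤ 1' →
    let Aₑ = a ⨾ (a ˘ ⨾ a ˘) · b ⨾ a ⨾ b ˘ ⨾ a ˘ · (b ⨾ b) ⨾ b ˘
        _⊗_ = λ (x y : Carrier) → a ⨾ x ⨾ a ˘ · b ⨾ y ⨾ b ˘
    in ∀ x → (Aₑ ⨾ (1' ⊗ x) ⨾ Aₑ ˘ ≡ 1' ⊗ (1' ⊗ x))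
           × (Aₑ ˘ ⨾ (x ⊗ 1') ⨾ Aₑ ≡ (x ⊗ 1') ⊗ 1')
proposition72 𝔄 a b a-univalent b-univalent 𝟙≡a˘⨾b 𝟙≡a⨾𝟙 𝟙≡b⨾𝟙 projections-injective x =
  α-conj-1'⊗ x , α˘-conj-⊗1' x
  where
    open Relational.Pairing 𝔄 a b a-univalent b-univalent
      (sym 𝟙≡a˘⨾b) (sym 𝟙≡a⨾𝟙) (sym 𝟙≡b⨾𝟙) projections-injective
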